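{- Let $G$ be a digraph and $H$ a butterfly minor of $G$. Then $\mathsf{circ}(H)\le\mathsf{circ}(G)$.
   Context: The circumference $\mathsf{circ}(G)$ of a digraph $G$ is the length of a longest directed cycle in $G$ if $G$ has a directed cycle, and $0$ otherwise. An edge $(u,v)$ is butterfly contractible if it is the only edge with tail $u$ or the only edge with head $v$; butterfly contraction identifies $u,v$ into a new vertex $x$, deletes $(u,v)$, replaces each $(z,u)$ by $(z,x)$ and each $(v,z)$ by $(x,z)$, and deletes multiple edges. A butterfly minor of $G$ is (isomorphic to) a digraph obtained from $G$ by a sequence of vertex deletions, edge deletions and butterfly contractions. -}

module Defs where

open import Data.Nat using (ℕ; zero; suc; _≤_; _<_)
open import Data.Fin using (Fin; zero; suc; inject₁; fromℕ; punchIn; punchOut; _≟_)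
open import Data.Product using (Σ; ∃; _×_; _,_)
open import Data.Sum using (_⊎_)
open import Data.Empty using (⊥)
open import Relation.Nullary using (¬_; yes; no)
open import Relation.Binary.PropositionalEquality using (_≡_; _≢_; sym)
open import Function.Bundles using (_↔_; Inverse)
open import Function.Definitions using (Injective)

-- A (finite) digraph: vertex set Fin size, arbitrary edge relation.
-- No multiple edges (edge relation); loops are allowed.
record Digraph : Set₁ where
  field
    size : ℕ
    Edge : Fin size → Fin size → Set
open Digraph public

-- A directed cycle of length (suc m): pairwise distinct vertices c 0 … c m
-- with edges c i → c (i+1) and c m → c 0.
record Cycle (G : Digraph) (m : ℕ) : Set where
  field
    vtx  : Fin (suc m) → Fin (size G)
    inj  : Injective _≡_ _≡_ vtx
    step : (i : Fin m) → Edge G (vtx (inject₁ i)) (vtx (suc i))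
    wrap : Edge G (vtx (fromℕ m)) (vtx zero)

HasCycleOfLength : Digraph → ℕ → Set
HasCycleOfLength G zero    = ⊥
HasCycleOfLength G (suc m) = Cycle G m

Acyclic : Digraph → Set
Acyclic G = ∀ k → ¬ HasCycleOfLength G k

IsCirc : Digraph → ℕ → Set
IsCirc G c = (c ≡ 0 × Acyclic G)
           ⊎ (HasCycleOfLength G c × (∀ k → HasCycleOfLength G k → k ≤ c))

record Iso (G H : Digraph) : Set where
  field
    bij  : Fin (size G) ↔ Fin (size H)
    pres : ∀ a b → Edge G a b → Edge H (Inverse.to bij a) (Inverse.to bij b)
    refl' : ∀ a b → Edge H (Inverse.to bij a) (Inverse.to bij b) → Edge G a b

deleteVertex : (n : ℕ) → (Fin (suc n) → Fin (suc n) → Set) → Fin (suc n) → Digraph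
deleteVertex n E v = record { size = n ; Edge = λ a b → E (punchIn v a) (punchIn v b) }

deleteEdge : (G : Digraph) → Fin (size G) → Fin (size G) → Digraph
deleteEdge G u v = record { size = size G
                          ; Edge = λ a b → Edge G a b × ¬ (a ≡ u × b ≡ v) }

ButterflyContractible : (G : Digraph) → Fin (size G) → Fin (size G) → Set
ButterflyContractible G u v =
  Edge G u v × (u ≢ v) ×
  ((∀ w → Edge G u w → w ≡ v) ⊎ (∀ w → Edge G w v → w ≡ u))

-- The quotient map identifying v with u (vertices other than v are
-- renumbered by punchOut; v is sent to where u goes).
contractMap : (n : ℕ) → (u v : Fin (suc n)) → u ≢ v → Fin (suc n) → Fin n
contractMap n u v u≢v a with a ≟ v
... | yes _   = punchOut {i = v} {j = u} (λ eq → u≢v (sym eq))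
... | no a≢v  = punchOut {i = v} {j = a} (λ eq → a≢v (sym eq))

-- Butterfly contraction of (u , v) in a digraph on Fin (suc n): u and v are
-- identified into a new vertex x, the edge (u , v) is deleted, all other
-- edges are kept with endpoints renamed (parallel edges merge, since the
-- edge relation is a relation).
contract : (n : ℕ) → (Fin (suc n) → Fin (suc n) → Set)
         → (u v : Fin (suc n)) → u ≢ v → Digraph
contract n E u v u≢v = record
  { size = n
  ; Edge = λ x y → Σ (Fin (suc n)) λ a → Σ (Fin (suc n)) λ b →
             E a b × ¬ (a ≡ u × b ≡ v) ×
             contractMap n u v u≢v a ≡ x × contractMap n u v u≢v b ≡ y }

data Step : Digraph → Digraph → Set₁ where
  vdel : (n : ℕ) (E : Fin (suc n) → Fin (suc n) → Set) (v : Fin (suc n)) →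
         Step (record { size = suc n ; Edge = E }) (deleteVertex n E v)
  edel : (G : Digraph) (u v : Fin (size G)) → Step G (deleteEdge G u v)
  bcon : (n : ℕ) (E : Fin (suc n) → Fin (suc n) → Set) (u v : Fin (suc n))
         (u≢v : u ≢ v) →
         ButterflyContractible (record { size = suc n ; Edge = E }) u v →
         Step (record { size = suc n ; Edge = E }) (contract n E u v u≢v)

data ButterflyMinor (H : Digraph) : Digraph → Set₁ where
  iso  : ∀ {G} → Iso G H → ButterflyMinor H G
  step : ∀ {G G'} → Step G G' → ButterflyMinor H G' → ButterflyMinor H G

-- Each minor operation maps cycles of the minor to cycles of the original
-- digraph that are at least as long.  For vertex and edge deletions and
-- isomorphisms this is the image of the cycle under an injective
-- homomorphism.  For the butterfly contraction of (u , v) into x, a cycle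
-- avoiding x lifts verbatim; a cycle through x lifts to a walk between two
-- vertices of {u , v}.  That walk is closed, or runs from v to u and closes
-- up with the edge (u , v), or runs from u to v — which is impossible:
-- its first edge would leave u towards a vertex other than v and its last
-- edge would enter v from a vertex other than u.
module Submission where

open import Defs
open import Data.Nat using (ℕ; zero; suc; _≤_; z≤n)
open import Data.Nat.Properties using (≤-refl; ≤-reflexive; ≤-trans; n≤1+n; suc-injective)
open import Data.Fin as Fin using (Fin; inject₁; fromℕ; punchIn; punchOut)
open import Data.Fin.Properties
  using (punchIn-injective; punchInᵢ≢i; punchOut-cong; punchIn-punchOut; punchOut-punchIn)
open import Data.Vec.Functional using (Vector) renaming (_∷_ to _∷ᵛ_)
open import Data.List using (List; []; _∷_; _++_; map; length; tabulate)
open import Data.List.Properties using (length-map; length-tabulate)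
open import Data.List.Relation.Unary.All using (All; []; _∷_)
import Data.List.Relation.Unary.All.Properties as All
open import Data.List.Relation.Unary.Any using (any?)
open import Data.List.Relation.Unary.AllPairs using ([]; _∷_)
open import Data.List.Relation.Unary.Unique.Propositional using (Unique)
import Data.List.Relation.Unary.Unique.Propositional.Properties as Unique
open import Data.List.Membership.Propositional using (_∈_)
open import Data.List.Membership.Propositional.Properties using (∈-∃++)
import Data.List.Relation.Binary.Permutation.Setoid.Properties as Perm
open import Data.Product using (Σ; ∃-syntax; _×_; _,_; proj₁; proj₂)
open import Data.Sum using (_⊎_; inj₁; inj₂)
open import Data.Empty using (⊥-elim)
open import Function using (_∘_)
open import Function.Bundles using (Inverse)
open import Relation.Nullary using (¬_; Dec; yes; no)
open import Relation.Binary.Definitions using (DecidableEquality)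
open import Relation.Binary.PropositionalEquality

-- Walk E a c l: a walk from a to c whose vertices, the endpoint c excluded,
-- are listed by l.
data Walk {V : Set} (E : V → V → Set) : V → V → List V → Set where
  []  : ∀ {a} → Walk E a a []
  _∷_ : ∀ {a b c l} → E a b → Walk E b c l → Walk E a c (a ∷ l)

module _ {V : Set} {E : V → V → Set} where

  _++ᵂ_ : ∀ {a b c l m} → Walk E a b l → Walk E b c m → Walk E a c (l ++ m)
  []      ++ᵂ q = q
  (e ∷ p) ++ᵂ q = e ∷ (p ++ᵂ q)

  walk-split : ∀ {a c} l m → Walk E a c (l ++ m) →
               ∃[ b ] Walk E a b l × Walk E b c m
  walk-split []      m p       = _ , [] , p
  walk-split (_ ∷ l) m (e ∷ p) with b , p₁ , p₂ ← walk-split l m p = b , e ∷ p₁ , p₂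

  walk-head : ∀ {a c x l} → Walk E a c (x ∷ l) → a ≡ x
  walk-head (_ ∷ _) = refl

  walk-start : ∀ {P : V → Set} {a c l} → Walk E a c l → All P l → P c → P a
  walk-start []      _        Pc = Pc
  walk-start (_ ∷ _) (Pa ∷ _) _  = Pa

  walk-tabulate⁺ : ∀ m (f : Fin (suc m) → V) →
                   (∀ i → E (f (inject₁ i)) (f (Fin.suc i))) →
                   ∀ {c} → E (f (fromℕ m)) c → Walk E (f Fin.zero) c (tabulate f)
  walk-tabulate⁺ zero    f steps last = last ∷ []
  walk-tabulate⁺ (suc m) f steps last =
    steps Fin.zero ∷ walk-tabulate⁺ m (f ∘ Fin.suc) (steps ∘ Fin.suc) last

  walk-tabulate⁻ : ∀ m (f : Fin (suc m) → V) {a c} → Walk E a c (tabulate f) →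
                   a ≡ f Fin.zero × (∀ i → E (f (inject₁ i)) (f (Fin.suc i))) ×
                   E (f (fromℕ m)) c
  walk-tabulate⁻ zero    f (e ∷ []) = refl , (λ ()) , e
  walk-tabulate⁻ (suc m) f (e ∷ p)
    with refl , steps , last ← walk-tabulate⁻ m (f ∘ Fin.suc) p = refl , steps′ , last
    where
    steps′ : ∀ i → E (f (inject₁ i)) (f (Fin.suc i))
    steps′ Fin.zero    = e
    steps′ (Fin.suc i) = steps i

module _ {V W : Set} {E : V → V → Set} {F : W → W → Set} (h : V → W)
         (hom : ∀ {a b} → E a b → F (h a) (h b)) where

  map-walk : ∀ {a c l} → Walk E a c l → Walk F (h a) (h c) (map h l)
  map-walk []      = []
  map-walk (e ∷ p) = hom e ∷ map-walk p

tabulate-injective : ∀ {A : Set} {n} (f : Fin n → A) → Unique (tabulate f) →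
                     ∀ {i j} → f i ≡ f j → i ≡ j
tabulate-injective f _            {Fin.zero}  {Fin.zero}  _ = refl
tabulate-injective f (f₀∉ ∷ _)    {Fin.zero}  {Fin.suc j} eq = ⊥-elim (All.tabulate⁻ f₀∉ j eq)
tabulate-injective f (f₀∉ ∷ _)    {Fin.suc i} {Fin.zero}  eq = ⊥-elim (All.tabulate⁻ f₀∉ i (sym eq))
tabulate-injective f (_ ∷ unique) {Fin.suc i} {Fin.suc j} eq =
  cong Fin.suc (tabulate-injective (f ∘ Fin.suc) unique eq)

tabulate-surjective : ∀ {A : Set} {n} (l : List A) → length l ≡ n →
                      Σ (Vector A n) λ f → tabulate f ≡ l
tabulate-surjective []      refl = (λ ()) , refl
tabulate-surjective {n = suc n} (x ∷ l) eq
  with f , refl ← tabulate-surjective l (suc-injective eq) = x ∷ᵛ f , refl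

-- The empty walk counts as a cycle of length 0.
record ListCycle {V : Set} (E : V → V → Set) : Set where
  field
    start    : V
    vertices : List V
    walk     : Walk E start start vertices
    unique   : Unique vertices
open ListCycle

cycleLength : ∀ {V : Set} {E : V → V → Set} → ListCycle E → ℕ
cycleLength C = length (vertices C)

CycleAtLeast : ∀ {V : Set} (E : V → V → Set) → ℕ → Set
CycleAtLeast E k = Σ (ListCycle E) λ C → k ≤ cycleLength C

module _ {V : Set} {E : V → V → Set} where

  rotate : (C : ListCycle E) → ∀ {x} → x ∈ vertices C →
           ∃[ ys ] Walk E x x (x ∷ ys) × Unique (x ∷ ys) × length (x ∷ ys) ≡ cycleLength C
  rotate C {x} x∈C with ys , zs , refl ← ∈-∃++ x∈C
               with _ , p₁ , p₂ ← walk-split ys (_ ∷ zs) (walk C)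
               with refl ← walk-head p₂
    = zs ++ ys , p₂ ++ᵂ p₁ , Perm.Unique-resp-↭ (setoid V) swapped (unique C)
    , sym (Perm.xs↭ys⇒|xs|≡|ys| (setoid V) swapped)
    where
    open import Data.List.Relation.Binary.Permutation.Setoid (setoid V) using (_↭_)
    swapped : ys ++ x ∷ zs ↭ x ∷ zs ++ ys
    swapped = Perm.++-comm (setoid V) ys (x ∷ zs)

module _ {V W : Set} {E : V → V → Set} {F : W → W → Set} (h : V → W)
         (injective : ∀ {a b} → h a ≡ h b → a ≡ b)
         (hom : ∀ {a b} → E a b → F (h a) (h b)) where

  map-listCycle : (C : ListCycle E) → CycleAtLeast F (cycleLength C)
  map-listCycle C =
    record { start    = h (start C)
           ; vertices = map h (vertices C)
           ; walk     = map-walk h hom (walk C)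
           ; unique   = Unique.map⁺ injective (unique C) }
    , ≤-reflexive (sym (length-map h (vertices C)))

cycle⇒listCycle : ∀ {G m} → Cycle G m → CycleAtLeast (Edge G) (suc m)
cycle⇒listCycle {m = m} C =
  record { start    = vtx Fin.zero
         ; vertices = tabulate vtx
         ; walk     = walk-tabulate⁺ m vtx (Cycle.step C) wrap
         ; unique   = Unique.tabulate⁺ inj }
  , ≤-reflexive (sym (length-tabulate vtx))
  where
  open Cycle C using (vtx; inj; wrap)

listCycle⇒cycle : ∀ {G m} (C : ListCycle (Edge G)) → cycleLength C ≡ suc m → Cycle G m
listCycle⇒cycle {G} {m} C len
  with f , refl ← tabulate-surjective (vertices C) len
  with refl , steps , last ← walk-tabulate⁻ m f (walk C)
  = record { vtx = f ; inj = tabulate-injective f (unique C) ; step = steps ; wrap = last }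

-- For π = contractMap this is definitionally the edge relation of contract.
Contracted : ∀ {V W : Set} → (V → V → Set) → (V → W) → V → V → W → W → Set
Contracted {V} E π u v y z =
  Σ V λ a → Σ V λ b → E a b × ¬ (a ≡ u × b ≡ v) × π a ≡ y × π b ≡ z

module ButterflyContraction
  {V W : Set} (_≟_ : DecidableEquality W) (E : V → V → Set)
  (π : V → W) (σ : W → V) (u v : V)
  (π∘σ : ∀ y → π (σ y) ≡ y)
  (σ∘π : ∀ a → π u ≢ π a → σ (π a) ≡ a)
  (πv≡πu : π v ≡ π u)
  (π-fibre : ∀ a → π a ≡ π u → a ≡ u ⊎ a ≡ v)
  (contractible : E u v × u ≢ v × ((∀ w → E u w → w ≡ v) ⊎ (∀ w → E w v → w ≡ u)))
  where

  private
    E′ : W → W → Set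
    E′ = Contracted E π u v
    x : W
    x = π u
    OnlyEdgeIntoV : Set
    OnlyEdgeIntoV = ∀ w → E w v → w ≡ u
    u→v : E u v
    u→v = proj₁ contractible
    u≢v : u ≢ v
    u≢v = proj₁ (proj₂ contractible)

  σ-injective : ∀ {y z} → σ y ≡ σ z → y ≡ z
  σ-injective {y} {z} eq = trans (sym (π∘σ y)) (trans (cong π eq) (π∘σ z))

  preimage-off-x : ∀ {a y} → π a ≡ y → x ≢ y → a ≡ σ y
  preimage-off-x {a} refl x≢πa = sym (σ∘π a x≢πa)

  σ-avoids-fibre : ∀ {b} → π b ≡ x → ∀ {ys} → All (x ≢_) ys → All (b ≢_) (map σ ys)
  σ-avoids-fibre πb []              = []
  σ-avoids-fibre πb {y ∷ _} (x≢y ∷ rest) =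
    (λ b≡σy → x≢y (trans (sym πb) (trans (cong π b≡σy) (π∘σ y)))) ∷ σ-avoids-fibre πb rest

  lift-edge-off-x : ∀ {y z} → E′ y z → x ≢ y → x ≢ z → E (σ y) (σ z)
  lift-edge-off-x (_ , _ , e , _ , πa , πb) x≢y x≢z =
    subst₂ E (preimage-off-x πa x≢y) (preimage-off-x πb x≢z) e

  lift-walk-off-x : ∀ {y c l} → Walk E′ y c l → All (x ≢_) l → x ≢ c →
                    Walk E (σ y) (σ c) (map σ l)
  lift-walk-off-x []      _            _   = []
  lift-walk-off-x (e ∷ p) (x≢y ∷ rest) x≢c =
    lift-edge-off-x e x≢y (walk-start p rest x≢c) ∷ lift-walk-off-x p rest x≢c

  -- The flag records that the lifted walk cannot end in v when v has only the
  -- in-edge (u , v): its last edge starts at σ y with y ≠ x, so not at u.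
  lift-walk-into-x : ∀ {y l} → Walk E′ y x (y ∷ l) → All (x ≢_) (y ∷ l) →
                     ∃[ b ] π b ≡ x × Walk E (σ y) b (map σ (y ∷ l)) ×
                            (OnlyEdgeIntoV → b ≢ v)
  lift-walk-into-x ((a , b , e , _ , πa , πb) ∷ []) (x≢y ∷ []) =
    b , πb , subst (λ t → E t b) (preimage-off-x πa x≢y) e ∷ [] ,
    λ onlyIn b≡v → x≢y (trans (cong π (sym (onlyIn a (subst (E a) b≡v e)))) πa)
  lift-walk-into-x (e ∷ p@(_ ∷ _)) (x≢y ∷ rest@(x≢z ∷ _))
    with b , πb , q , flag ← lift-walk-into-x p rest =
    b , πb , lift-edge-off-x e x≢y x≢z ∷ q , flag

  lift-closed-walk-at-x : ∀ {ys} → Walk E′ x x (x ∷ ys) → All (x ≢_) ys →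
    Σ V λ a → Σ V λ b → π a ≡ x × π b ≡ x × ¬ (a ≡ u × b ≡ v) × Walk E a b (a ∷ map σ ys)
  lift-closed-walk-at-x ((a , b , e , not-uv , πa , πb) ∷ []) [] =
    a , b , πa , πb , not-uv , e ∷ []
  lift-closed-walk-at-x ((a , b₀ , e , _ , πa , πb₀) ∷ p@(_ ∷ _)) rest@(x≢y ∷ _)
    with b , πb , q , flag ← lift-walk-into-x p rest =
    a , b , πa , πb , not-uv , subst (E a) (preimage-off-x πb₀ x≢y) e ∷ q
    where
    not-uv : ¬ (a ≡ u × b ≡ v)
    not-uv (refl , refl) with proj₂ (proj₂ contractible)
    ... | inj₁ onlyOut =
      x≢y (trans (sym πv≡πu) (trans (cong π (sym (onlyOut b₀ e))) πb₀))
    ... | inj₂ onlyIn = flag onlyIn refl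

  close-at-fibre : ∀ {c ys} → π c ≡ x → Walk E c c (c ∷ map σ ys) → All (x ≢_) ys → Unique ys →
                   CycleAtLeast E (suc (length ys))
  close-at-fibre {c} {ys} πc p off uniq =
    record { start    = c
           ; vertices = c ∷ map σ ys
           ; walk     = p
           ; unique   = σ-avoids-fibre πc off ∷ Unique.map⁺ σ-injective uniq }
    , subst (suc (length ys) ≤_) (cong suc (sym (length-map σ ys))) ≤-refl

  close-with-u→v : ∀ {ys} → Walk E v u (v ∷ map σ ys) → All (x ≢_) ys → Unique ys →
                   CycleAtLeast E (suc (length ys))
  close-with-u→v {ys} p off uniq =
    record { start    = u
           ; vertices = u ∷ v ∷ map σ ys
           ; walk     = u→v ∷ p
           ; unique   = (u≢v ∷ σ-avoids-fibre refl off)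
                        ∷ (σ-avoids-fibre πv≡πu off ∷ Unique.map⁺ σ-injective uniq) }
    , subst (suc (length ys) ≤_) (cong (suc ∘ suc) (sym (length-map σ ys))) (n≤1+n _)

  close-lifted-walk : ∀ {a b ys} → π a ≡ x → π b ≡ x → ¬ (a ≡ u × b ≡ v) →
                      Walk E a b (a ∷ map σ ys) → All (x ≢_) ys → Unique ys →
                      CycleAtLeast E (suc (length ys))
  close-lifted-walk {a} {b} πa πb not-uv p with π-fibre a πa | π-fibre b πb
  ... | inj₁ refl | inj₂ refl = ⊥-elim (not-uv (refl , refl))
  ... | inj₁ refl | inj₁ refl = close-at-fibre πa p
  ... | inj₂ refl | inj₂ refl = close-at-fibre πa p
  ... | inj₂ refl | inj₁ refl = close-with-u→v p

  lift-cycle-avoiding-x : ∀ {a l} → Walk E′ a a l → All (x ≢_) l → Unique l →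
                          CycleAtLeast E (length l)
  lift-cycle-avoiding-x [] _ _ =
    record { start = u ; vertices = [] ; walk = [] ; unique = [] } , z≤n
  lift-cycle-avoiding-x {a} {l} p@(_ ∷ _) off@(x≢a ∷ _) uniq =
    record { start    = σ a
           ; vertices = map σ l
           ; walk     = lift-walk-off-x p off x≢a
           ; unique   = Unique.map⁺ σ-injective uniq }
    , subst (length l ≤_) (sym (length-map σ l)) ≤-refl

  lift-listCycle : (C : ListCycle E′) → CycleAtLeast E (cycleLength C)
  lift-listCycle C with any? (x ≟_) (vertices C)
  ... | no x∉C = lift-cycle-avoiding-x (walk C) (All.¬Any⇒All¬ _ x∉C) (unique C)
  ... | yes x∈C
    with ys , p , off ∷ uniq , len ← rotate C x∈C
    with a , b , πa , πb , not-uv , q ← lift-closed-walk-at-x p off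
    with C′ , ≥ys ← close-lifted-walk πa πb not-uv q off uniq
    = C′ , subst (_≤ cycleLength C′) len ≥ys

module _ (n : ℕ) (u v : Fin (suc n)) (u≢v : u ≢ v) where

  private
    π : Fin (suc n) → Fin n
    π = contractMap n u v u≢v

  contractMap-≢ : ∀ {a} (a≢v : a ≢ v) → π a ≡ punchOut (a≢v ∘ sym)
  contractMap-≢ {a} a≢v with a Fin.≟ v
  ... | yes a≡v = ⊥-elim (a≢v a≡v)
  ... | no _    = punchOut-cong v refl

  contractMap-v : π v ≡ π u
  contractMap-v with v Fin.≟ v
  ... | yes _   = trans (punchOut-cong v refl) (sym (contractMap-≢ u≢v))
  ... | no v≢v  = ⊥-elim (v≢v refl)

  contractMap-punchIn : ∀ y → π (punchIn v y) ≡ y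
  contractMap-punchIn y =
    trans (contractMap-≢ (punchInᵢ≢i v y)) (trans (punchOut-cong v refl) (punchOut-punchIn v))

  punchIn-contractMap : ∀ {a} → a ≢ v → punchIn v (π a) ≡ a
  punchIn-contractMap a≢v rewrite contractMap-≢ a≢v = punchIn-punchOut _

  punchIn-contractMap-off : ∀ a → π u ≢ π a → punchIn v (π a) ≡ a
  punchIn-contractMap-off a πu≢πa =
    punchIn-contractMap (λ a≡v → πu≢πa (trans (sym contractMap-v) (cong π (sym a≡v))))

  contractMap-fibre : ∀ a → π a ≡ π u → a ≡ u ⊎ a ≡ v
  contractMap-fibre a πa≡πu = by-cases (a Fin.≟ v)
    where
    by-cases : Dec (a ≡ v) → a ≡ u ⊎ a ≡ v
    by-cases (yes a≡v) = inj₂ a≡v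
    by-cases (no a≢v)  = inj₁ (trans (sym (punchIn-contractMap a≢v))
                                     (trans (cong (punchIn v) πa≡πu) (punchIn-contractMap u≢v)))

step-lift : ∀ {G G′} → Step G G′ → (C : ListCycle (Edge G′)) → CycleAtLeast (Edge G) (cycleLength C)
step-lift (vdel n E v) =
  map-listCycle (punchIn v) (punchIn-injective v _ _) (λ e → e)
step-lift (edel G u v) = map-listCycle (λ a → a) (λ eq → eq) proj₁
step-lift (bcon n E u v u≢v contractible) =
  ButterflyContraction.lift-listCycle Fin._≟_ E (contractMap n u v u≢v) (punchIn v) u v
    (contractMap-punchIn n u v u≢v) (punchIn-contractMap-off n u v u≢v)
    (contractMap-v n u v u≢v) (contractMap-fibre n u v u≢v) contractible

iso-lift : ∀ {G H} → Iso G H → (C : ListCycle (Edge H)) → CycleAtLeast (Edge G) (cycleLength C)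
iso-lift {G} {H} i = map-listCycle from from-injective from-hom
  where
  open Iso i
  open Inverse bij using (to; from; strictlyInverseˡ)
  from-injective : ∀ {a b} → from a ≡ from b → a ≡ b
  from-injective {a} {b} eq =
    trans (sym (strictlyInverseˡ a)) (trans (cong to eq) (strictlyInverseˡ b))
  from-hom : ∀ {a b} → Edge H a b → Edge G (from a) (from b)
  from-hom {a} {b} e =
    refl' (from a) (from b) (subst₂ (Edge H) (sym (strictlyInverseˡ a)) (sym (strictlyInverseˡ b)) e)

minor-lift : ∀ {H G} → ButterflyMinor H G → ∀ {k} → CycleAtLeast (Edge H) k → CycleAtLeast (Edge G) k
minor-lift (iso i) (C , k≤C) with C′ , C≤C′ ← iso-lift i C = C′ , ≤-trans k≤C C≤C′
minor-lift (step s m) D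
  with C , k≤C ← minor-lift m D
  with C′ , C≤C′ ← step-lift s C
  = C′ , ≤-trans k≤C C≤C′

IsCirc-longest : ∀ {G c k} → IsCirc G c → HasCycleOfLength G k → k ≤ c
IsCirc-longest (inj₁ (_ , acyclic)) C = ⊥-elim (acyclic _ C)
IsCirc-longest (inj₂ (_ , longest)) C = longest _ C

lemma8p1 : (G H : Digraph) → ButterflyMinor H G →
    (cG cH : ℕ) → IsCirc G cG → IsCirc H cH → cH ≤ cG
lemma8p1 G H m cG cH circG (inj₁ (refl , _)) = z≤n
lemma8p1 G H m cG (suc k) circG (inj₂ (cycleH , _))
  with C , k<C ← minor-lift m (cycle⇒listCycle cycleH)
  with suc k′ ← cycleLength C in len
  = ≤-trans k<C (IsCirc-longest circG (listCycle⇒cycle C len))
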